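{- Let $(U,\mathcal{F},\kappa)$ be an instance of \textsc{Hitting Set} with $|U|=n$ and $0\le\kappa\le n$. Construct a graph $G$ as follows: its vertices are $m_F$ for each $F\in\mathcal{F}$, $v_u$ for each $u\in U$ (let $Q_1=\{v_u:u\in U\}$), a set $Q_2$ of $n-\kappa$ further vertices, and two vertices $m_1,m_2$. Its edges: $Q_1$ is a clique, $Q_2$ is a clique, $m_1$ and $m_2$ are adjacent to each other and to all vertices of $Q_1\cup Q_2$, and for each $F\in\mathcal{F}$, $N_G(m_F)=\{v_u:u\in F\}$; there are no other edges. Let $\ell=n+2$. Then $(U,\mathcal{F},\kappa)$ is a yes-instance of \textsc{Hitting Set} if and only if $(G,\ell)$ is a yes-instance of \textsc{Dominator Coloring}.
   Context: \textsc{Hitting Set}: given a finite set $U$, a family $\mathcal{F}$ of subsets of $U$ and an integer $\kappa$, decide whether there is $S\subseteq U$ with $|S|\le\kappa$ and $S\cap F\neq\emptyset$ for all $F\in\mathcal{F}$. A dominator coloring of $G$ is a proper coloring in which every vertex $v$ dominates some color class (the class is contained in $N_G[v]=N_G(v)\cup\{v\}$). \textsc{Dominator Coloring}: given $(G,\ell)$, decide whether $G$ has a dominator coloring with at most $\ell$ colors. -}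

module Defs where

open import Data.Nat using (ℕ; _≤_; _∸_)
open import Data.Fin using (Fin)
open import Data.Fin.Subset using (Subset; _∈_; ∣_∣)
open import Data.Product using (Σ; ∃; _×_)
open import Data.Sum using (_⊎_)
open import Data.Unit using (⊤)
open import Data.Empty using (⊥)
open import Relation.Binary.PropositionalEquality using (_≡_; _≢_)

HittingSetYes : (n k : ℕ) → (Fin k → Subset n) → ℕ → Set
HittingSetYes n k F κ =
  Σ (Subset n) λ S → (∣ S ∣ ≤ κ) × (∀ (j : Fin k) → ∃ λ u → (u ∈ S) × (u ∈ F j))

IsProperColoring : {V : Set} → (V → V → Set) → {ℓ : ℕ} → (V → Fin ℓ) → Set
IsProperColoring {V} E c = ∀ (u w : V) → E u w → c u ≢ c w

Dominates : {V : Set} → (V → V → Set) → {ℓ : ℕ} → (V → Fin ℓ) → V → Fin ℓ → Set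
Dominates {V} E c v i = (∃ λ w → c w ≡ i) × (∀ (w : V) → c w ≡ i → (w ≡ v) ⊎ E v w)

IsDominatorColoring : {V : Set} → (V → V → Set) → {ℓ : ℕ} → (V → Fin ℓ) → Set
IsDominatorColoring {V} E {ℓ} c =
  IsProperColoring E c × (∀ (v : V) → ∃ λ (i : Fin ℓ) → Dominates E c v i)

DominatorColoringYes : (V : Set) → (V → V → Set) → ℕ → Set
DominatorColoringYes V E ℓ = Σ (V → Fin ℓ) λ c → IsDominatorColoring E c

data Vtx (n k κ : ℕ) : Set where
  mF : Fin k → Vtx n k κ
  vU : Fin n → Vtx n k κ
  q2 : Fin (n ∸ κ) → Vtx n k κ
  m₁ : Vtx n k κ
  m₂ : Vtx n k κ

Adj : (n k κ : ℕ) → (Fin k → Subset n) → Vtx n k κ → Vtx n k κ → Set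
Adj n k κ F (vU a) (vU b) = a ≢ b
Adj n k κ F (q2 a) (q2 b) = a ≢ b
Adj n k κ F m₁ m₂ = ⊤
Adj n k κ F m₂ m₁ = ⊤
Adj n k κ F m₁ (vU _) = ⊤
Adj n k κ F m₁ (q2 _) = ⊤
Adj n k κ F m₂ (vU _) = ⊤
Adj n k κ F m₂ (q2 _) = ⊤
Adj n k κ F (vU _) m₁ = ⊤
Adj n k κ F (q2 _) m₁ = ⊤
Adj n k κ F (vU _) m₂ = ⊤
Adj n k κ F (q2 _) m₂ = ⊤
Adj n k κ F (mF j) (vU u) = u ∈ F j
Adj n k κ F (vU u) (mF j) = u ∈ F j
Adj n k κ F _ _ = ⊥

{-# OPTIONS --safe #-}
module Submission where

-- From a hitting set S: give each v_u its own color, give Q₂ the colors of n − κ distinct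
-- v_u with u ∉ S, and use two more colors, one for m₁ together with all m_F and one for m₂
-- alone. Every vertex but the m_F dominates {m₂}; m_F dominates the class of a v_u with
-- u ∈ S ∩ F, which contains no Q₂-vertex.
-- Conversely, m₁, m₂ and Q₁ form a clique of n + 2 vertices, so it uses every color. Hence
-- each Q₂-vertex, being adjacent to m₁ and m₂, shares its color with some v_u, distinct
-- Q₂-vertices with distinct v_u. The class dominated by m_F lies in N[m_F], so it is the
-- class of some v_u with u ∈ F and contains no Q₂-vertex: the u whose class avoids Q₂ form
-- a hitting set, of size at most n − (n − κ) = κ.

open import Defs
open import Data.Bool using (true)
open import Data.Nat using (ℕ; zero; suc; _≤_; _+_; _∸_; z≤n; s≤s)
open import Data.Nat.Properties
  using (≤-trans; ≤-reflexive; +-comm; 1+n≰n; ∸-monoʳ-≤; m∸[m∸n]≡n; module ≤-Reasoning)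
open import Data.Fin using (Fin; zero; suc; cast; lift; punchOut)
open import Data.Fin.Properties
  using (_≟_; any?; suc-injective; 0≢1+n; lift-injective; cast-involutive; punchOut-injective; injective⇒≤)
open import Data.Fin.Subset using (Subset; inside; outside; _∈_; _∉_; ∣_∣; ∁; _-_)
open import Data.Fin.Subset.Properties
  using (x∈p∧x≢y⇒x∈p-y; x∈p⇒∣p-x∣<∣p∣; ∣∁p∣≡n∸∣p∣; x∈∁p⇒x∉p; x∉p⇒x∈∁p)
open import Data.Vec using (_∷_; here; there; tabulate)
open import Data.Vec.Properties using (lookup∘tabulate; []=⇒lookup; lookup⇒[]=)
open import Data.Product using (Σ; ∃; _×_; _,_; proj₁; proj₂)
open import Data.Sum using (_⊎_; inj₁; inj₂; [_,_]′)
open import Data.Unit using (tt)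
open import Function using (_∘_; id; case_of_)
open import Function.Definitions using (Injective)
open import Function.Bundles using (_⇔_; mk⇔)
open import Relation.Nullary using (yes; no; does; contradiction)
open import Relation.Nullary.Decidable using (dec-true; dec-false; decidable-stable)
open import Relation.Unary using (Pred; Decidable)
open import Relation.Binary.PropositionalEquality
  using (_≡_; _≢_; refl; sym; trans; cong; subst; module ≡-Reasoning)

toSubset : ∀ {n p} {P : Pred (Fin n) p} → Decidable P → Subset n
toSubset P? = tabulate (does ∘ P?)

module _ {n p} {P : Pred (Fin n) p} (P? : Decidable P) where

  ∈-toSubset⁺ : ∀ {x} → P x → x ∈ toSubset P?
  ∈-toSubset⁺ {x} px = lookup⇒[]= x _ (trans (lookup∘tabulate _ x) (dec-true (P? x) px))

  ∈-toSubset⁻ : ∀ {x} → x ∈ toSubset P? → P x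
  ∈-toSubset⁻ {x} x∈ =
    decidable-stable (P? x) λ ¬px → case trans (sym (dec-false (P? x) ¬px)) does≡true of λ ()
    where
    does≡true : does (P? x) ≡ true
    does≡true = trans (sym (lookup∘tabulate _ x)) ([]=⇒lookup x∈)

InjectionInto : ∀ {n} → ℕ → Subset n → Set
InjectionInto {n} m p = Σ (Fin m → Fin n) λ g → Injective _≡_ _≡_ g × (∀ i → g i ∈ p)

injectionInto⇒≤∣p∣ : ∀ {m n} {p : Subset n} → InjectionInto m p → m ≤ ∣ p ∣
injectionInto⇒≤∣p∣ {zero} _ = z≤n
injectionInto⇒≤∣p∣ {suc m} {p = p} (g , g-inj , g∈p) =
  ≤-trans (s≤s (injectionInto⇒≤∣p∣ {p = p - g zero} (g ∘ suc , tail-inj , tail∈)))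
          (x∈p⇒∣p-x∣<∣p∣ (g∈p zero))
  where
  tail-inj : Injective _≡_ _≡_ (g ∘ suc)
  tail-inj eq = suc-injective (g-inj eq)

  tail∈ : ∀ i → g (suc i) ∈ p - g zero
  tail∈ i = x∈p∧x≢y⇒x∈p-y (g∈p (suc i)) (λ eq → 0≢1+n (sym (g-inj eq)))

≤∣p∣⇒injectionInto : ∀ {m n} (p : Subset n) → m ≤ ∣ p ∣ → InjectionInto m p
≤∣p∣⇒injectionInto {zero} p _ = (λ ()) , (λ { {()} }) , (λ ())
≤∣p∣⇒injectionInto {suc m} (outside ∷ p) 1+m≤∣p∣
  with g , g-inj , g∈p ← ≤∣p∣⇒injectionInto p 1+m≤∣p∣
  = suc ∘ g , g-inj ∘ suc-injective , there ∘ g∈p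
≤∣p∣⇒injectionInto {suc m} (inside ∷ p) (s≤s m≤∣p∣)
  with g , g-inj , g∈p ← ≤∣p∣⇒injectionInto p m≤∣p∣
  = lift 1 g , lift-injective g g-inj 1 , λ { zero → here ; (suc i) → there (g∈p i) }

injective⇒surjective : ∀ {m n} {f : Fin m → Fin n} → n ≤ m → Injective _≡_ _≡_ f →
                       ∀ y → ∃ λ x → f x ≡ y
injective⇒surjective {m} {suc n} {f} 1+n≤m f-inj y with any? (λ x → f x ≟ y)
... | yes hit = hit
... | no miss = contradiction (≤-trans 1+n≤m (injective⇒≤ punchOut-y∘f-inj)) 1+n≰n
  where
  y≢f : ∀ x → y ≢ f x
  y≢f x = miss ∘ (x ,_) ∘ sym

  punchOut-y∘f : Fin m → Fin n
  punchOut-y∘f x = punchOut (y≢f x)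

  punchOut-y∘f-inj : Injective _≡_ _≡_ punchOut-y∘f
  punchOut-y∘f-inj {x} {x′} = f-inj ∘ punchOut-injective (y≢f x) (y≢f x′)

cast-injective : ∀ {m n} (eq : m ≡ n) → Injective _≡_ _≡_ (cast eq)
cast-injective eq {x} {y} cx≡cy = begin
  x                         ≡⟨ cast-involutive (sym eq) eq x ⟨
  cast (sym eq) (cast eq x) ≡⟨ cong (cast (sym eq)) cx≡cy ⟩
  cast (sym eq) (cast eq y) ≡⟨ cast-involutive (sym eq) eq y ⟩
  y                         ∎
  where open ≡-Reasoning

module _ {V : Set} {E : V → V → Set} where

  isDominatorColoring-map : ∀ {ℓ ℓ′} {c : V → Fin ℓ} {f : Fin ℓ → Fin ℓ′} → Injective _≡_ _≡_ f →
                            IsDominatorColoring E c → IsDominatorColoring E (f ∘ c)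
  isDominatorColoring-map {f = f} f-inj (proper , dominating) =
    (λ u w e → proper u w e ∘ f-inj) ,
    λ v → let i , (w , cw≡i) , class⊆N[v] = dominating v
          in f i , (w , cong f cw≡i) , λ w′ → class⊆N[v] w′ ∘ f-inj

  dominatorColoringYes-cast : ∀ {ℓ ℓ′} → ℓ ≡ ℓ′ →
                              DominatorColoringYes V E ℓ → DominatorColoringYes V E ℓ′
  dominatorColoringYes-cast eq (c , c-dom) = cast eq ∘ c , isDominatorColoring-map (cast-injective eq) c-dom

  proper⇒injective-on-clique : ∀ {ℓ m} {c : V → Fin ℓ} → IsProperColoring E c →
                               (f : Fin m → V) → (∀ {i j} → i ≢ j → E (f i) (f j)) →
                               Injective _≡_ _≡_ (c ∘ f)
  proper⇒injective-on-clique proper f clique {i} {j} eq =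
    decidable-stable (i ≟ j) λ i≢j → proper (f i) (f j) (clique i≢j) eq

module _ {n k κ : ℕ} (F : Fin k → Subset n) where

  private
    G : Set
    G = Vtx n k κ

    E : G → G → Set
    E = Adj n k κ F

  module FromHittingSet (S : Subset n) (∣S∣≤κ : ∣ S ∣ ≤ κ) (hits : ∀ j → ∃ λ u → u ∈ S × u ∈ F j) where

    private
      Q₂-partners : InjectionInto (n ∸ κ) (∁ S)
      Q₂-partners = ≤∣p∣⇒injectionInto (∁ S)
        (subst (n ∸ κ ≤_) (sym (∣∁p∣≡n∸∣p∣ S)) (∸-monoʳ-≤ n ∣S∣≤κ))

      g : Fin (n ∸ κ) → Fin n
      g = proj₁ Q₂-partners

      g-inj : Injective _≡_ _≡_ g
      g-inj = proj₁ (proj₂ Q₂-partners)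

      g∈∁S : ∀ i → g i ∈ ∁ S
      g∈∁S = proj₂ (proj₂ Q₂-partners)

    color : G → Fin (2 + n)
    color (mF _) = zero
    color m₁ = zero
    color m₂ = suc zero
    color (vU u) = suc (suc u)
    color (q2 i) = suc (suc (g i))

    color-proper : IsProperColoring E color
    color-proper (mF _) (mF _) ()
    color-proper (mF _) (vU _) _ ()
    color-proper (mF _) (q2 _) ()
    color-proper (mF _) m₁ ()
    color-proper (mF _) m₂ ()
    color-proper (vU _) (mF _) _ ()
    color-proper (vU _) (vU _) u≢u′ eq = u≢u′ (suc-injective (suc-injective eq))
    color-proper (vU _) (q2 _) ()
    color-proper (vU _) m₁ _ ()
    color-proper (vU _) m₂ _ ()
    color-proper (q2 _) (mF _) ()
    color-proper (q2 _) (vU _) ()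
    color-proper (q2 _) (q2 _) i≢i′ eq = i≢i′ (g-inj (suc-injective (suc-injective eq)))
    color-proper (q2 _) m₁ _ ()
    color-proper (q2 _) m₂ _ ()
    color-proper m₁ (mF _) ()
    color-proper m₁ (vU _) _ ()
    color-proper m₁ (q2 _) _ ()
    color-proper m₁ m₁ ()
    color-proper m₁ m₂ _ ()
    color-proper m₂ (mF _) ()
    color-proper m₂ (vU _) _ ()
    color-proper m₂ (q2 _) _ ()
    color-proper m₂ m₁ _ ()
    color-proper m₂ m₂ ()

    color≡1⇒m₂ : ∀ w → color w ≡ suc zero → w ≡ m₂
    color≡1⇒m₂ (mF _) ()
    color≡1⇒m₂ m₁ ()
    color≡1⇒m₂ m₂ _ = refl
    color≡1⇒m₂ (vU _) ()
    color≡1⇒m₂ (q2 _) ()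

    dominates-m₂ : ∀ v → (m₂ ≡ v) ⊎ E v m₂ → Dominates E color v (suc zero)
    dominates-m₂ v m₂∈N[v] =
      (m₂ , refl) , λ w cw≡1 → subst (λ w → (w ≡ v) ⊎ E v w) (sym (color≡1⇒m₂ w cw≡1)) m₂∈N[v]

    dominates-class-of : ∀ j {u} → u ∈ S → u ∈ F j → Dominates E color (mF j) (suc (suc u))
    dominates-class-of j {u} u∈S u∈F = (vU u , refl) , class⊆N[mF]
      where
      class⊆N[mF] : ∀ w → color w ≡ suc (suc u) → (w ≡ mF j) ⊎ E (mF j) w
      class⊆N[mF] (vU _) refl = inj₂ u∈F
      class⊆N[mF] (q2 i) eq =
        contradiction (subst (_∈ S) (sym (suc-injective (suc-injective eq))) u∈S) (x∈∁p⇒x∉p (g∈∁S i))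
      class⊆N[mF] (mF _) ()
      class⊆N[mF] m₁ ()
      class⊆N[mF] m₂ ()

    color-dominating : ∀ v → ∃ λ i → Dominates E color v i
    color-dominating (mF j) = let u , u∈S , u∈F = hits j in suc (suc u) , dominates-class-of j u∈S u∈F
    color-dominating (vU u) = suc zero , dominates-m₂ (vU u) (inj₂ tt)
    color-dominating (q2 i) = suc zero , dominates-m₂ (q2 i) (inj₂ tt)
    color-dominating m₁ = suc zero , dominates-m₂ m₁ (inj₂ tt)
    color-dominating m₂ = suc zero , dominates-m₂ m₂ (inj₁ refl)

    color-isDominatorColoring : IsDominatorColoring E color
    color-isDominatorColoring = color-proper , color-dominating

  clique : Fin (2 + n) → G
  clique zero = m₁
  clique (suc zero) = m₂
  clique (suc (suc u)) = vU u

  clique-adjacent : ∀ {i j} → i ≢ j → E (clique i) (clique j)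
  clique-adjacent {zero} {zero} i≢j = contradiction refl i≢j
  clique-adjacent {zero} {suc zero} _ = tt
  clique-adjacent {zero} {suc (suc _)} _ = tt
  clique-adjacent {suc zero} {zero} _ = tt
  clique-adjacent {suc zero} {suc zero} i≢j = contradiction refl i≢j
  clique-adjacent {suc zero} {suc (suc _)} _ = tt
  clique-adjacent {suc (suc _)} {zero} _ = tt
  clique-adjacent {suc (suc _)} {suc zero} _ = tt
  clique-adjacent {suc (suc _)} {suc (suc _)} u≢u′ = u≢u′ ∘ cong λ u → suc (suc u)

  module FromColoring {ℓ} (c : G → Fin ℓ) (ℓ≤2+n : ℓ ≤ 2 + n) (c-dom : IsDominatorColoring E c) where

    private
      proper : IsProperColoring E c
      proper = proj₁ c-dom

      dominating : ∀ v → ∃ λ i → Dominates E c v i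
      dominating = proj₂ c-dom

    clique-uses-every-color : ∀ x → ∃ λ j → c (clique j) ≡ x
    clique-uses-every-color =
      injective⇒surjective ℓ≤2+n (proper⇒injective-on-clique proper clique clique-adjacent)

    Q₂-color-on-Q₁ : ∀ i → ∃ λ u → c (vU u) ≡ c (q2 i)
    Q₂-color-on-Q₁ i with clique-uses-every-color (c (q2 i))
    ... | zero , c≡ = contradiction c≡ (proper m₁ (q2 i) tt)
    ... | suc zero , c≡ = contradiction c≡ (proper m₂ (q2 i) tt)
    ... | suc (suc u) , c≡ = u , c≡

    colored-on-Q₂? : Decidable λ u → ∃ λ i → c (q2 i) ≡ c (vU u)
    colored-on-Q₂? u = any? λ i → c (q2 i) ≟ c (vU u)

    colored-on-Q₂ : Subset n
    colored-on-Q₂ = toSubset colored-on-Q₂?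

    Q₂-partners : InjectionInto (n ∸ κ) colored-on-Q₂
    Q₂-partners = proj₁ ∘ Q₂-color-on-Q₁ , partner-inj ,
                  λ i → ∈-toSubset⁺ colored-on-Q₂? (i , sym (proj₂ (Q₂-color-on-Q₁ i)))
      where
      open ≡-Reasoning
      partner-inj : Injective _≡_ _≡_ (proj₁ ∘ Q₂-color-on-Q₁)
      partner-inj {i} {i′} u≡u′ = proper⇒injective-on-clique proper q2 id (begin
        c (q2 i)                           ≡⟨ proj₂ (Q₂-color-on-Q₁ i) ⟨
        c (vU (proj₁ (Q₂-color-on-Q₁ i)))  ≡⟨ cong (c ∘ vU) u≡u′ ⟩
        c (vU (proj₁ (Q₂-color-on-Q₁ i′))) ≡⟨ proj₂ (Q₂-color-on-Q₁ i′) ⟩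
        c (q2 i′)                          ∎)

    hittingSet : Subset n
    hittingSet = ∁ colored-on-Q₂

    hittingSet-size : κ ≤ n → ∣ hittingSet ∣ ≤ κ
    hittingSet-size κ≤n = begin
      ∣ ∁ colored-on-Q₂ ∣     ≡⟨ ∣∁p∣≡n∸∣p∣ colored-on-Q₂ ⟩
      n ∸ ∣ colored-on-Q₂ ∣   ≤⟨ ∸-monoʳ-≤ n (injectionInto⇒≤∣p∣ Q₂-partners) ⟩
      n ∸ (n ∸ κ)              ≡⟨ m∸[m∸n]≡n κ≤n ⟩
      κ                        ∎
      where open ≤-Reasoning

    hittingSet-hits : ∀ j → ∃ λ u → u ∈ hittingSet × u ∈ F j
    hittingSet-hits j with x , _ , class⊆N[mF] ← dominating (mF j) | clique-uses-every-color x
    ... | zero , c≡x = [ (λ ()) , (λ ()) ]′ (class⊆N[mF] m₁ c≡x)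
    ... | suc zero , c≡x = [ (λ ()) , (λ ()) ]′ (class⊆N[mF] m₂ c≡x)
    ... | suc (suc u) , c≡x = u , x∉p⇒x∈∁p u∉colored-on-Q₂ , [ (λ ()) , id ]′ (class⊆N[mF] (vU u) c≡x)
      where
      u∉colored-on-Q₂ : u ∉ colored-on-Q₂
      u∉colored-on-Q₂ u∈ with i , c≡ ← ∈-toSubset⁻ colored-on-Q₂? u∈ =
        [ (λ ()) , (λ ()) ]′ (class⊆N[mF] (q2 i) (trans c≡ c≡x))

theorem17 : (n k κ : ℕ) (F : Fin k → Subset n) → Injective _≡_ _≡_ F → κ ≤ n →
    HittingSetYes n k F κ ⇔ DominatorColoringYes (Vtx n k κ) (Adj n k κ F) (n + 2)
theorem17 n k κ F _ κ≤n = mk⇔ toColoring toHittingSet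
  where
  toColoring : HittingSetYes n k F κ → DominatorColoringYes (Vtx n k κ) (Adj n k κ F) (n + 2)
  toColoring (S , ∣S∣≤κ , hits) =
    dominatorColoringYes-cast (+-comm 2 n) (color , color-isDominatorColoring)
    where open FromHittingSet F S ∣S∣≤κ hits

  toHittingSet : DominatorColoringYes (Vtx n k κ) (Adj n k κ F) (n + 2) → HittingSetYes n k F κ
  toHittingSet (c , c-dom) = hittingSet , hittingSet-size κ≤n , hittingSet-hits
    where open FromColoring F c (≤-reflexive (+-comm n 2)) c-dom
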